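{- For all integers $r\geq 2$, $\frac{r^2}{2}< \hat{R}_r(P_{4})\leq (r+1)(2r+1)$.
   Context: $P_4$ is the graph path on $4$ vertices. For graphs $G,H$, $G\to_r H$ means every $r$-coloring of the edges of $G$ contains a monochromatic copy of $H$; $\hat R_r(H)$ is the minimum number of edges of a graph $G$ with $G\to_r H$. -}

module Defs where

open import Data.Nat using (ℕ; _+_; _*_; _≤_; _<_; _<ᵇ_)
open import Data.Bool using (Bool; true; false; if_then_else_; _∧_)
open import Data.Fin using (Fin; toℕ)
open import Data.List using (List; map; allFin; cartesianProduct)
open import Data.Nat.ListAction using (sum)
open import Data.Product using (Σ; _×_; _,_; ∃-syntax)
open import Relation.Binary.PropositionalEquality using (_≡_; _≢_)

record SimpleGraph (n : ℕ) : Set where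
  field
    Adj   : Fin n → Fin n → Bool
    sym   : ∀ x y → Adj x y ≡ Adj y x
    irrefl : ∀ x → Adj x x ≡ false
open SimpleGraph public

edgeCount : {n : ℕ} → SimpleGraph n → ℕ
edgeCount {n} G =
  sum (map (λ { (i , j) → if (toℕ i <ᵇ toℕ j) ∧ Adj G i j then 1 else 0 })
           (cartesianProduct (allFin n) (allFin n)))

-- An r-colouring of the edges of a graph on Fin n: a symmetric function
-- on pairs of vertices (only its values on edges matter).
record EdgeColouring (r n : ℕ) : Set where
  field
    col    : Fin n → Fin n → Fin r
    colSym : ∀ x y → col x y ≡ col y x
open EdgeColouring public

MonoP4 : {r n : ℕ} → SimpleGraph n → EdgeColouring r n → Set
MonoP4 {r} {n} G χ =
  ∃[ a ] ∃[ b ] ∃[ c ] ∃[ d ]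
    ( (a ≢ b × a ≢ c × a ≢ d × b ≢ c × b ≢ d × c ≢ d)
    × (Adj G a b ≡ true × Adj G b c ≡ true × Adj G c d ≡ true)
    × (col χ a b ≡ col χ b c × col χ b c ≡ col χ c d) )

Arrows : (r : ℕ) {n : ℕ} → SimpleGraph n → Set
Arrows r {n} G = (χ : EdgeColouring r n) → MonoP4 G χ

IsSizeRamseyP4 : ℕ → ℕ → Set
IsSizeRamseyP4 r m =
  (Σ ℕ λ n → Σ (SimpleGraph n) λ G → Arrows r G × edgeCount G ≡ m)
  × (∀ n (G : SimpleGraph n) → Arrows r G → m ≤ edgeCount G)

module Submission where

-- Upper bound: colour K_{2r+2} with r colours. If no class contained a P4, each class would
-- have at most as many edges as vertices (a vertex of degree at least 2 has no neighbour of
-- degree at least 3), giving at most r(2r+2) < (r+1)(2r+1) edges in total.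
-- Lower bound: a graph with 2e ≤ r² can be r-coloured so that every colour class is a star
-- forest, which contains no P4. While some vertex has degree > r its star gets its own
-- colour; this lowers the degree sum by at least 2(r+1), and (r+1)² - 2(r+1) < r². Once all
-- degrees are at most r, removing a minimal edge cover of the non-isolated vertices (a star
-- forest) lowers every positive degree, so r such removals empty the graph.
-- The minimum exists constructively because arrowing is decidable for a fixed graph and
-- deleting isolated vertices preserves arrowing, so only graphs on at most 2e vertices
-- need to be searched.

open import Defs hiding (sym)
open import Data.Bool using (Bool; true; false; not; _∧_; _∨_; if_then_else_)
import Data.Bool.Properties as Bool
open import Data.Empty using (⊥-elim)
open import Data.Fin using (Fin; zero; suc; toℕ; fromℕ<; punchIn; punchOut)
open import Data.Fin.Properties using (any?; all?; toℕ-injective; toℕ-fromℕ<; punchInᵢ≢i; punchIn-punchOut;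
  punchOut-cong; punchOut-injective) renaming (_≟_ to _≟ᶠ_)
open import Data.List using (List; []; _∷_; [_]; length; map; foldl; allFin; tabulate; cartesianProduct; _++_)
open import Data.List.Properties using (map-++; map-∘; map-tabulate; map-cong)
open import Data.List.Membership.Propositional using (_∈_; _∉_)
open import Data.List.Membership.Propositional.Properties using (∈-cartesianProduct⁺; ∈-allFin)
open import Data.List.Relation.Unary.Any using (here; there)
import Data.List.Relation.Unary.Any as Any
open import Data.Nat using (ℕ; zero; suc; _+_; _*_; _≤_; _<_; _≤?_; _<?_; _<ᵇ_; z≤n; s≤s; s≤s⁻¹)
open import Data.Nat.Induction using (<-rec)
import Data.Nat.ListAction as List
open import Data.Nat.ListAction.Properties using (sum-++)
open import Data.Nat.Properties
open import Algebra.Properties.CommutativeMonoid.Sum +-0-commutativeMonoid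
  using (sum; sum-syntax; sum-cong-≗; ∑-distrib-+; ∑-comm; sum-remove)
open import Data.Nat.Tactic.RingSolver using (solve-∀)
open import Data.Product using (Σ; _×_; _,_; ∃; proj₁; proj₂)
open import Data.Sum using (_⊎_; inj₁; inj₂)
import Data.Sum as Sum
open import Data.Vec using (Vec; []; _∷_)
import Data.Vec as Vec
open import Data.Vec.Properties using (lookup∘tabulate)
open import Function using (_∘_; case_of_)
open import Relation.Binary using (DecidableEquality; tri<; tri≈; tri>)
open import Relation.Binary.PropositionalEquality hiding ([_])
open import Relation.Nullary using (¬_; Dec; yes; no)
open import Relation.Nullary.Decidable using (does; dec-true; dec-false; does-≡; decidable-stable; _×-dec_; ¬?)
import Relation.Nullary.Decidable as Dec

private variable n : ℕ

-- Defined by if_then_else_ so that edgeCount from Defs unfolds to a sum of 𝟙's.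
𝟙 : Bool → ℕ
𝟙 b = if b then 1 else 0

∧-trueˡ : ∀ {a b} → a ∧ b ≡ true → a ≡ true
∧-trueˡ {true} _ = refl

𝟙-split : ∀ a b → 𝟙 a ≡ 𝟙 (a ∧ b) + 𝟙 (a ∧ not b)
𝟙-split false b     = refl
𝟙-split true  true  = refl
𝟙-split true  false = refl

𝟙-∧≤ : ∀ a b → 𝟙 (a ∧ b) ≤ 𝟙 a
𝟙-∧≤ false b     = z≤n
𝟙-∧≤ true  true  = ≤-refl
𝟙-∧≤ true  false = z≤n

sum-mono-≤ : {f g : Fin n → ℕ} → (∀ i → f i ≤ g i) → sum f ≤ sum g
sum-mono-≤ {zero}  f≤g = z≤n
sum-mono-≤ {suc n} f≤g = +-mono-≤ (f≤g zero) (sum-mono-≤ (f≤g ∘ suc))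

sum-const : ∀ n c → ∑[ i < n ] c ≡ n * c
sum-const zero    c = refl
sum-const (suc n) c = cong (c +_) (sum-const n c)

sum-zero : {f : Fin n → ℕ} → (∀ i → f i ≡ 0) → sum f ≡ 0
sum-zero {zero}  f≡0 = refl
sum-zero {suc n} f≡0 = cong₂ _+_ (f≡0 zero) (sum-zero (f≡0 ∘ suc))

term≤sum : (f : Fin n → ℕ) (i : Fin n) → f i ≤ sum f
term≤sum f zero    = m≤m+n _ _
term≤sum f (suc i) = ≤-trans (term≤sum (f ∘ suc) i) (m≤n+m _ _)

sum-single : (f : Fin n → ℕ) (v : Fin n) → (∀ i → i ≢ v → f i ≡ 0) → sum f ≡ f v
sum-single {suc n} f v f≡0 = begin
  sum f                             ≡⟨ sum-remove {i = v} f ⟩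
  f v + ∑[ i < n ] f (punchIn v i)  ≡⟨ cong (f v +_) (sum-zero (λ i → f≡0 _ (punchInᵢ≢i v i))) ⟩
  f v + 0                           ≡⟨ +-identityʳ (f v) ⟩
  f v                               ∎
  where open ≡-Reasoning

sum-select : (g : Fin n → Bool) (v : Fin n) → ∑[ x < n ] 𝟙 (g x ∧ does (x ≟ᶠ v)) ≡ 𝟙 (g v)
sum-select g v = trans (sum-single (λ x → 𝟙 (g x ∧ does (x ≟ᶠ v))) v elsewhere) (cong 𝟙 at-v)
  where
  elsewhere : ∀ x → x ≢ v → 𝟙 (g x ∧ does (x ≟ᶠ v)) ≡ 0
  elsewhere x x≢v = cong 𝟙 (trans (cong (g x ∧_) (dec-false (x ≟ᶠ v) x≢v)) (Bool.∧-zeroʳ (g x)))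
  at-v : g v ∧ does (v ≟ᶠ v) ≡ g v
  at-v = trans (cong (g v ∧_) (dec-true (v ≟ᶠ v) refl)) (Bool.∧-identityʳ (g v))

sum-tabulate : (f : Fin n → ℕ) → List.sum (tabulate f) ≡ sum f
sum-tabulate {zero}  f = refl
sum-tabulate {suc n} f = cong (f zero +_) (sum-tabulate (f ∘ suc))

sum-allFin : (f : Fin n → ℕ) → List.sum (map f (allFin n)) ≡ sum f
sum-allFin f = trans (cong List.sum (map-tabulate (λ i → i) f)) (sum-tabulate f)

sum-cartesianProduct : ∀ {A B : Set} (h : A × B → ℕ) xs ys →
  List.sum (map h (cartesianProduct xs ys)) ≡ List.sum (map (λ x → List.sum (map (λ y → h (x , y)) ys)) xs)
sum-cartesianProduct h []       ys = refl
sum-cartesianProduct h (x ∷ xs) ys = begin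
  List.sum (map h (map (x ,_) ys ++ cartesianProduct xs ys))
    ≡⟨ cong List.sum (map-++ h (map (x ,_) ys) _) ⟩
  List.sum (map h (map (x ,_) ys) ++ map h (cartesianProduct xs ys))
    ≡⟨ sum-++ (map h (map (x ,_) ys)) _ ⟩
  List.sum (map h (map (x ,_) ys)) + List.sum (map h (cartesianProduct xs ys))
    ≡⟨ cong₂ _+_ (cong List.sum (sym (map-∘ ys))) (sum-cartesianProduct h xs ys) ⟩
  List.sum (map (λ y → h (x , y)) ys) + List.sum (map (λ x → List.sum (map (λ y → h (x , y)) ys)) xs) ∎
  where open ≡-Reasoning

degree : SimpleGraph n → Fin n → ℕ
degree {n} G x = ∑[ y < n ] 𝟙 (Adj G x y)

degreeSum : SimpleGraph n → ℕ
degreeSum {n} G = ∑[ x < n ] degree G x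

edgeCount≡∑∑ : (G : SimpleGraph n) →
  edgeCount G ≡ ∑[ i < n ] ∑[ j < n ] 𝟙 ((toℕ i <ᵇ toℕ j) ∧ Adj G i j)
edgeCount≡∑∑ {n} G =
  trans (sum-cartesianProduct _ (allFin n) (allFin n))
    (trans (cong List.sum (map-cong (λ i → sum-allFin (λ j → 𝟙 ((toℕ i <ᵇ toℕ j) ∧ Adj G i j))) (allFin n)))
      (sum-allFin (λ i → ∑[ j < n ] 𝟙 ((toℕ i <ᵇ toℕ j) ∧ Adj G i j))))

adjacency-split : (G : SimpleGraph n) (i j : Fin n) →
  𝟙 (Adj G i j) ≡ 𝟙 ((toℕ i <ᵇ toℕ j) ∧ Adj G i j) + 𝟙 ((toℕ j <ᵇ toℕ i) ∧ Adj G j i)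
adjacency-split G i j with <-cmp (toℕ i) (toℕ j)
... | tri< i<j _ j≮i
  rewrite dec-true (toℕ i <? toℕ j) i<j | dec-false (toℕ j <? toℕ i) j≮i = sym (+-identityʳ _)
... | tri> i≮j _ j<i
  rewrite dec-false (toℕ i <? toℕ j) i≮j | dec-true (toℕ j <? toℕ i) j<i | SimpleGraph.sym G i j = refl
... | tri≈ _ i≡j _ with refl ← toℕ-injective i≡j rewrite irrefl G i | Bool.∧-zeroʳ (toℕ i <ᵇ toℕ i) = refl

handshake : (G : SimpleGraph n) → degreeSum G ≡ 2 * edgeCount G
handshake {n} G = begin
  ∑[ i < n ] ∑[ j < n ] 𝟙 (Adj G i j)
    ≡⟨ sum-cong-≗ (λ i → trans (sum-cong-≗ (adjacency-split G i)) (∑-distrib-+ (X i) (λ j → X j i))) ⟩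
  ∑[ i < n ] (∑[ j < n ] X i j + ∑[ j < n ] X j i)
    ≡⟨ ∑-distrib-+ (λ i → ∑[ j < n ] X i j) (λ i → ∑[ j < n ] X j i) ⟩
  ∑[ i < n ] ∑[ j < n ] X i j + ∑[ i < n ] ∑[ j < n ] X j i
    ≡⟨ cong (∑[ i < n ] ∑[ j < n ] X i j +_) (trans (∑-comm (λ i j → X j i)) (sym (+-identityʳ _))) ⟩
  2 * ∑[ i < n ] ∑[ j < n ] X i j
    ≡⟨ cong (2 *_) (sym (edgeCount≡∑∑ G)) ⟩
  2 * edgeCount G ∎
  where
  open ≡-Reasoning
  X : Fin n → Fin n → ℕ
  X i j = 𝟙 ((toℕ i <ᵇ toℕ j) ∧ Adj G i j)

edge⇒≢ : (G : SimpleGraph n) {x y : Fin n} → Adj G x y ≡ true → x ≢ y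
edge⇒≢ G {x} e refl with () ← trans (sym (irrefl G x)) e

edge⇒degree≥1 : (G : SimpleGraph n) {x y : Fin n} → Adj G x y ≡ true → 1 ≤ degree G x
edge⇒degree≥1 G {x} {y} e = ≤-trans (≤-reflexive (cong 𝟙 (sym e))) (term≤sum (𝟙 ∘ Adj G x) y)

_∈?_ : (y : Fin n) (xs : List (Fin n)) → Dec (y ∈ xs)
y ∈? xs = Any.any? (y ≟ᶠ_) xs

count-members : (xs : List (Fin n)) → ∑[ y < n ] 𝟙 (does (y ∈? xs)) ≤ length xs
count-members {n} []       = ≤-reflexive (sum-zero {n} (λ _ → refl))
count-members {n} (z ∷ zs) = begin
  ∑[ y < n ] 𝟙 (does (y ≟ᶠ z) ∨ does (y ∈? zs))
    ≤⟨ sum-mono-≤ (λ y → 𝟙-∨≤ (does (y ≟ᶠ z)) (does (y ∈? zs))) ⟩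
  ∑[ y < n ] (𝟙 (does (y ≟ᶠ z)) + 𝟙 (does (y ∈? zs)))
    ≡⟨ ∑-distrib-+ (λ y → 𝟙 (does (y ≟ᶠ z))) _ ⟩
  ∑[ y < n ] 𝟙 (does (y ≟ᶠ z)) + ∑[ y < n ] 𝟙 (does (y ∈? zs))
    ≤⟨ +-mono-≤ (≤-reflexive (sum-select (λ _ → true) z)) (count-members zs) ⟩
  1 + length zs                                         ∎
  where
  open ≤-Reasoning
  𝟙-∨≤ : ∀ a b → 𝟙 (a ∨ b) ≤ 𝟙 a + 𝟙 b
  𝟙-∨≤ false b = ≤-refl
  𝟙-∨≤ true  b = m≤m+n 1 (𝟙 b)

neighbour-outside : (G : SimpleGraph n) (x : Fin n) (xs : List (Fin n)) →
  length xs < degree G x → ∃ λ y → Adj G x y ≡ true × y ∉ xs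
neighbour-outside G x xs few with any? (λ y → (Adj G x y Bool.≟ true) ×-dec ¬? (y ∈? xs))
... | yes found = found
... | no none = ⊥-elim (<⇒≱ few (≤-trans (sum-mono-≤ bound) (count-members xs)))
  where
  bound : ∀ y → 𝟙 (Adj G x y) ≤ 𝟙 (does (y ∈? xs))
  bound y with Adj G x y in e | y ∈? xs
  ... | false | _      = z≤n
  ... | true  | yes _  = ≤-refl
  ... | true  | no y∉ = ⊥-elim (none (y , e , y∉))

restrict : (G : SimpleGraph n) (S : Fin n → Fin n → Bool) → (∀ x y → S x y ≡ S y x) → SimpleGraph n
restrict G S S-sym = record
  { Adj    = λ x y → Adj G x y ∧ S x y
  ; sym    = λ x y → cong₂ _∧_ (SimpleGraph.sym G x y) (S-sym x y)
  ; irrefl = λ x → cong (_∧ S x x) (irrefl G x)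
  }

_⊆ᴳ_ : SimpleGraph n → SimpleGraph n → Set
F ⊆ᴳ G = ∀ {x y} → Adj F x y ≡ true → Adj G x y ≡ true

_∖_ : SimpleGraph n → SimpleGraph n → SimpleGraph n
G ∖ F = restrict G (λ x y → not (Adj F x y)) (λ x y → cong not (SimpleGraph.sym F x y))

∖-edge : (G F : SimpleGraph n) {x y : Fin n} → Adj G x y ≡ true → Adj F x y ≡ false → Adj (G ∖ F) x y ≡ true
∖-edge G F Gxy Fxy rewrite Gxy | Fxy = refl

degree-∖ : (G F : SimpleGraph n) → F ⊆ᴳ G → ∀ x → degree G x ≡ degree (G ∖ F) x + degree F x
degree-∖ G F F⊆G x = trans (sum-cong-≗ split) (∑-distrib-+ (𝟙 ∘ Adj (G ∖ F) x) (𝟙 ∘ Adj F x))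
  where
  split : ∀ y → 𝟙 (Adj G x y) ≡ 𝟙 (Adj G x y ∧ not (Adj F x y)) + 𝟙 (Adj F x y)
  split y with Adj F x y in Fxy
  ... | true  rewrite F⊆G Fxy = refl
  ... | false rewrite Bool.∧-identityʳ (Adj G x y) = sym (+-identityʳ _)

degreeSum-∖ : (G F : SimpleGraph n) → F ⊆ᴳ G → degreeSum G ≡ degreeSum (G ∖ F) + degreeSum F
degreeSum-∖ G F F⊆G = trans (sum-cong-≗ (degree-∖ G F F⊆G)) (∑-distrib-+ (degree (G ∖ F)) (degree F))

-- P4-free graphs

Path4 : SimpleGraph n → Fin n → Fin n → Fin n → Fin n → Set
Path4 G a b c d =
  (a ≢ b × a ≢ c × a ≢ d × b ≢ c × b ≢ d × c ≢ d) ×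
  (Adj G a b ≡ true × Adj G b c ≡ true × Adj G c d ≡ true)

P4Free : SimpleGraph n → Set
P4Free {n} G = (a b c d : Fin n) → ¬ Path4 G a b c d

path4 : (G : SimpleGraph n) {a b c d : Fin n} → a ≢ c → a ≢ d → b ≢ d →
  Adj G a b ≡ true → Adj G b c ≡ true → Adj G c d ≡ true → Path4 G a b c d
path4 G a≢c a≢d b≢d ab bc cd =
  (edge⇒≢ G ab , a≢c , a≢d , edge⇒≢ G bc , b≢d , edge⇒≢ G cd) , (ab , bc , cd)

hub : SimpleGraph n → Fin n → Bool
hub G v = 2 <ᵇ degree G v

no-hub-next-to-degree≥2 : (G : SimpleGraph n) → P4Free G → {u v : Fin n} →
  2 ≤ degree G u → Adj G u v ≡ true → hub G v ≡ false
no-hub-next-to-degree≥2 G free {u} {v} du uv with 3 ≤? degree G v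
... | no  dv≱3 = dec-false (2 <? degree G v) dv≱3
... | yes dv≥3 with neighbour-outside G u [ v ] du
...   | x , ux , x∉[v] with neighbour-outside G v (u ∷ x ∷ []) dv≥3
...     | y , vy , y∉ux = ⊥-elim (free x u v y
          (path4 G (x∉[v] ∘ here) (y∉ux ∘ there ∘ here ∘ sym) (y∉ux ∘ here ∘ sym)
                 (trans (SimpleGraph.sym G x u) ux) uv vy))

-- Each ordered edge uv is charged to u if v is a hub and to v otherwise; in a P4-free
-- graph no vertex is charged more than twice.
charge : SimpleGraph n → Fin n → ℕ
charge {n} G u = ∑[ v < n ] 𝟙 (Adj G u v ∧ hub G v) + ∑[ v < n ] 𝟙 (Adj G u v ∧ not (hub G u))

degreeSum≡∑charge : (G : SimpleGraph n) → degreeSum G ≡ ∑[ u < n ] charge G u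
degreeSum≡∑charge {n} G = begin
  ∑[ u < n ] ∑[ v < n ] 𝟙 (Adj G u v)
    ≡⟨ sum-cong-≗ (λ u → trans (sum-cong-≗ (λ v → 𝟙-split (Adj G u v) (hub G v)))
                               (∑-distrib-+ (H u) (L u))) ⟩
  ∑[ u < n ] (∑[ v < n ] H u v + ∑[ v < n ] L u v)
    ≡⟨ ∑-distrib-+ (λ u → ∑[ v < n ] H u v) (λ u → ∑[ v < n ] L u v) ⟩
  ∑[ u < n ] ∑[ v < n ] H u v + ∑[ u < n ] ∑[ v < n ] L u v
    ≡⟨ cong (∑[ u < n ] ∑[ v < n ] H u v +_) (∑-comm L) ⟩
  ∑[ u < n ] ∑[ v < n ] H u v + ∑[ v < n ] ∑[ u < n ] L u v
    ≡⟨ cong (∑[ u < n ] ∑[ v < n ] H u v +_)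
         (sum-cong-≗ λ v → sum-cong-≗ λ u → cong (λ b → 𝟙 (b ∧ not (hub G v))) (SimpleGraph.sym G u v)) ⟩
  ∑[ u < n ] ∑[ v < n ] H u v + ∑[ u < n ] ∑[ v < n ] 𝟙 (Adj G u v ∧ not (hub G u))
    ≡⟨ ∑-distrib-+ (λ u → ∑[ v < n ] H u v) (λ u → ∑[ v < n ] 𝟙 (Adj G u v ∧ not (hub G u))) ⟨
  ∑[ u < n ] charge G u ∎
  where
  open ≡-Reasoning
  H L : Fin n → Fin n → ℕ
  H u v = 𝟙 (Adj G u v ∧ hub G v)
  L u v = 𝟙 (Adj G u v ∧ not (hub G v))

non-hub-charge≤2 : (G : SimpleGraph n) (u : Fin n) → ∑[ v < n ] 𝟙 (Adj G u v ∧ not (hub G u)) ≤ 2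
non-hub-charge≤2 {n} G u with hub G u in non-hub
... | true  = ≤-trans (≤-reflexive (sum-zero {n} (λ v → cong 𝟙 (Bool.∧-zeroʳ (Adj G u v))))) z≤n
... | false = ≤-trans (≤-reflexive (sum-cong-≗ (λ v → cong 𝟙 (Bool.∧-identityʳ (Adj G u v)))))
                      (≮⇒≥ λ degree>2 → case trans (sym non-hub) (dec-true (2 <? degree G u) degree>2) of λ ())

charge≤2 : (G : SimpleGraph n) → P4Free G → (u : Fin n) → charge G u ≤ 2
charge≤2 {n} G free u with degree G u ≤? 1
... | yes degree≤1 = +-mono-≤ (≤-trans (sum-mono-≤ (λ v → 𝟙-∧≤ (Adj G u v) _)) degree≤1)
                              (≤-trans (sum-mono-≤ (λ v → 𝟙-∧≤ (Adj G u v) _)) degree≤1)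
... | no  degree≰1 = ≤-trans (≤-reflexive (cong (_+ non-hub-charge) (sum-zero no-hub-neighbour))) (non-hub-charge≤2 G u)
  where
  non-hub-charge = ∑[ v < n ] 𝟙 (Adj G u v ∧ not (hub G u))
  no-hub-neighbour : ∀ v → 𝟙 (Adj G u v ∧ hub G v) ≡ 0
  no-hub-neighbour v with Adj G u v in uv
  ... | false = refl
  ... | true rewrite no-hub-next-to-degree≥2 G free (≰⇒> degree≰1) uv = refl

degreeSum-P4Free : (G : SimpleGraph n) → P4Free G → degreeSum G ≤ n * 2
degreeSum-P4Free {n} G free = begin
  degreeSum G             ≡⟨ degreeSum≡∑charge G ⟩
  ∑[ u < n ] charge G u   ≤⟨ sum-mono-≤ (charge≤2 G free) ⟩
  ∑[ u < n ] 2            ≡⟨ sum-const n 2 ⟩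
  n * 2                   ∎
  where open ≤-Reasoning

-- Dense graphs arrow P4

colourClass : {r : ℕ} → SimpleGraph n → EdgeColouring r n → Fin r → SimpleGraph n
colourClass G χ k =
  restrict G (λ x y → does (k ≟ᶠ col χ x y)) (λ x y → cong (λ c → does (k ≟ᶠ c)) (colSym χ x y))

colourClass-edge : {r : ℕ} (G : SimpleGraph n) (χ : EdgeColouring r n) {k : Fin r} {x y : Fin n} →
  Adj (colourClass G χ k) x y ≡ true → Adj G x y ≡ true × col χ x y ≡ k
colourClass-edge G χ {k} {x} {y} e with Adj G x y | k ≟ᶠ col χ x y
colourClass-edge G χ e  | true | yes k≡c = refl , sym k≡c
colourClass-edge G χ () | true | no _
colourClass-edge G χ () | false | _

colourClass-P4Free : {r : ℕ} (G : SimpleGraph n) (χ : EdgeColouring r n) → ¬ MonoP4 G χ →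
  ∀ k → P4Free (colourClass G χ k)
colourClass-P4Free G χ no-mono k a b c d (distinct , ab , bc , cd)
  with colourClass-edge G χ {k} ab | colourClass-edge G χ {k} bc | colourClass-edge G χ {k} cd
... | ab′ , ab≡k | bc′ , bc≡k | cd′ , cd≡k =
  no-mono (a , b , c , d , distinct , (ab′ , bc′ , cd′) , (trans ab≡k (sym bc≡k) , trans bc≡k (sym cd≡k)))

degreeSum-colourClasses : {r : ℕ} (G : SimpleGraph n) (χ : EdgeColouring r n) →
  degreeSum G ≡ ∑[ k < r ] degreeSum (colourClass G χ k)
degreeSum-colourClasses {n} {r} G χ = begin
  ∑[ x < n ] ∑[ y < n ] 𝟙 (Adj G x y)            ≡⟨ sum-cong-≗ (λ x → sum-cong-≗ (one-class x)) ⟨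
  ∑[ x < n ] ∑[ y < n ] ∑[ k < r ] C k x y        ≡⟨ sum-cong-≗ (λ x → ∑-comm (λ y k → C k x y)) ⟩
  ∑[ x < n ] ∑[ k < r ] ∑[ y < n ] C k x y        ≡⟨ ∑-comm (λ x k → ∑[ y < n ] C k x y) ⟩
  ∑[ k < r ] ∑[ x < n ] ∑[ y < n ] C k x y        ∎
  where
  open ≡-Reasoning
  C : Fin r → Fin n → Fin n → ℕ
  C k x y = 𝟙 (Adj (colourClass G χ k) x y)
  one-class : ∀ x y → ∑[ k < r ] C k x y ≡ 𝟙 (Adj G x y)
  one-class x y = sum-select (λ _ → Adj G x y) (col χ x y)

monoP4? : {r : ℕ} (G : SimpleGraph n) (χ : EdgeColouring r n) → Dec (MonoP4 G χ)
monoP4? G χ = any? λ a → any? λ b → any? λ c → any? λ d →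
  (¬? (a ≟ᶠ b) ×-dec ¬? (a ≟ᶠ c) ×-dec ¬? (a ≟ᶠ d) ×-dec
   ¬? (b ≟ᶠ c) ×-dec ¬? (b ≟ᶠ d) ×-dec ¬? (c ≟ᶠ d))
  ×-dec (Adj G a b Bool.≟ true ×-dec Adj G b c Bool.≟ true ×-dec Adj G c d Bool.≟ true)
  ×-dec (col χ a b ≟ᶠ col χ b c ×-dec col χ b c ≟ᶠ col χ c d)

-- Each colour class is P4-free, hence has average degree at most 2.
arrows-if-dense : (r : ℕ) (G : SimpleGraph n) → r * (n * 2) < degreeSum G → Arrows r G
arrows-if-dense {n} r G dense χ with monoP4? G χ
... | yes mono   = mono
... | no no-mono = ⊥-elim (<⇒≱ dense (begin
  degreeSum G                                     ≡⟨ degreeSum-colourClasses G χ ⟩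
  ∑[ k < r ] degreeSum (colourClass G χ k)        ≤⟨ sum-mono-≤ (λ k → degreeSum-P4Free (colourClass G χ k) (free k)) ⟩
  ∑[ k < r ] (n * 2)                              ≡⟨ sum-const r (n * 2) ⟩
  r * (n * 2)                                     ∎))
  where
  open ≤-Reasoning
  free = colourClass-P4Free G χ no-mono

complete : ∀ n → SimpleGraph n
complete n = record
  { Adj    = λ x y → not (does (y ≟ᶠ x))
  ; sym    = λ x y → cong not (does-≡ (y ≟ᶠ x) (Dec.map′ sym sym (x ≟ᶠ y)))
  ; irrefl = λ x → cong not (dec-true (x ≟ᶠ x) refl)
  }

degree-complete : ∀ m (x : Fin (suc m)) → degree (complete (suc m)) x ≡ m
degree-complete m x = +-cancelˡ-≡ 1 _ m (begin
  1 + ∑[ y < suc m ] 𝟙 (not (is-x y))                       ≡⟨ cong (_+ others) (sum-select (λ _ → true) x) ⟨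
  ∑[ y < suc m ] 𝟙 (is-x y) + others                         ≡⟨ ∑-distrib-+ (𝟙 ∘ is-x) (𝟙 ∘ not ∘ is-x) ⟨
  ∑[ y < suc m ] (𝟙 (is-x y) + 𝟙 (not (is-x y)))             ≡⟨ sum-cong-≗ (sym ∘ 𝟙-split true ∘ is-x) ⟩
  ∑[ y < suc m ] 1                                           ≡⟨ sum-const (suc m) 1 ⟩
  suc m * 1                                                  ≡⟨ *-identityʳ (suc m) ⟩
  1 + m                                                      ∎)
  where
  open ≡-Reasoning
  is-x : Fin (suc m) → Bool
  is-x y = does (y ≟ᶠ x)
  others = ∑[ y < suc m ] 𝟙 (not (is-x y))

degreeSum-complete : ∀ m → degreeSum (complete (suc m)) ≡ suc m * m
degreeSum-complete m = trans (sum-cong-≗ (degree-complete m)) (sum-const (suc m) m)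

complete-arrows : ∀ r → Arrows r (complete (2 + 2 * r))
complete-arrows r = arrows-if-dense r (complete (2 + 2 * r)) (begin-strict
  r * ((2 + 2 * r) * 2)     ≡⟨ lemma r ⟩
  (2 + 2 * r) * (2 * r)     <⟨ *-monoʳ-< (2 + 2 * r) (n<1+n (2 * r)) ⟩
  (2 + 2 * r) * (1 + 2 * r) ≡⟨ degreeSum-complete (1 + 2 * r) ⟨
  degreeSum (complete (2 + 2 * r)) ∎)
  where
  open ≤-Reasoning
  lemma : ∀ r → r * ((2 + 2 * r) * 2) ≡ (2 + 2 * r) * (2 * r)
  lemma = solve-∀

edgeCount-complete : ∀ r → edgeCount (complete (2 + 2 * r)) ≡ (r + 1) * (2 * r + 1)
edgeCount-complete r = *-cancelˡ-≡ _ _ 2 (begin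
  2 * edgeCount (complete (2 + 2 * r))   ≡⟨ handshake (complete (2 + 2 * r)) ⟨
  degreeSum (complete (2 + 2 * r))       ≡⟨ degreeSum-complete (1 + 2 * r) ⟩
  (2 + 2 * r) * (1 + 2 * r)              ≡⟨ lemma r ⟩
  2 * ((r + 1) * (2 * r + 1))            ∎)
  where
  open ≡-Reasoning
  lemma : ∀ r → (2 + 2 * r) * (1 + 2 * r) ≡ 2 * ((r + 1) * (2 * r + 1))
  lemma = solve-∀

-- Star colourings

OnlyNeighbour : SimpleGraph n → Fin n → Fin n → Set
OnlyNeighbour F x y = ∀ {z} → Adj F x z ≡ true → z ≡ y

StarForest : SimpleGraph n → Set
StarForest F = ∀ {x y} → Adj F x y ≡ true → OnlyNeighbour F x y ⊎ OnlyNeighbour F y x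

OnlyInColour : SimpleGraph n → (Fin n → Fin n → ℕ) → Fin n → Fin n → Set
OnlyInColour G c x y = ∀ {z} → Adj G x z ≡ true → c x z ≡ c x y → z ≡ y

-- Colours are natural numbers so that an edgeless graph has a colouring with
-- no colours at all; only their values on edges are bounded.
record StarColouring (G : SimpleGraph n) (k : ℕ) : Set where
  field
    colour     : Fin n → Fin n → ℕ
    colour-sym : ∀ x y → colour x y ≡ colour y x
    colour<    : ∀ {x y} → Adj G x y ≡ true → colour x y < k
    star       : ∀ {x y} → Adj G x y ≡ true → OnlyInColour G colour x y ⊎ OnlyInColour G colour y x

module _ (G F : SimpleGraph n) {k : ℕ} (F⊆G : F ⊆ᴳ G) (F-star : StarForest F) (c : StarColouring (G ∖ F) k) where
  private
    module C = StarColouring c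

    colour : Fin n → Fin n → ℕ
    colour x y = if Adj F x y then k else C.colour x y

    colour-new : ∀ {x y} → Adj F x y ≡ true → colour x y ≡ k
    colour-new {x} {y} Fxy = cong (if_then k else C.colour x y) Fxy

    colour-old : ∀ {x y} → Adj F x y ≡ false → colour x y ≡ C.colour x y
    colour-old {x} {y} Fxy = cong (if_then k else C.colour x y) Fxy

    old<k : ∀ {x y} → Adj G x y ≡ true → Adj F x y ≡ false → colour x y < k
    old<k Gxy Fxy = subst (_< k) (sym (colour-old Fxy)) (C.colour< (∖-edge G F Gxy Fxy))

    only-new : ∀ {x y} → Adj F x y ≡ true → OnlyNeighbour F x y → OnlyInColour G colour x y
    only-new {x} {y} Fxy only {z} Gxz same = by-cases (Adj F x z) refl
      where
      by-cases : ∀ b → Adj F x z ≡ b → z ≡ y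
      by-cases true  Fxz = only Fxz
      by-cases false Fxz = ⊥-elim (<-irrefl (trans same (colour-new Fxy)) (old<k Gxz Fxz))

    only-old : ∀ {x y} → Adj G x y ≡ true → Adj F x y ≡ false →
      OnlyInColour (G ∖ F) C.colour x y → OnlyInColour G colour x y
    only-old {x} {y} Gxy Fxy only {z} Gxz same = by-cases (Adj F x z) refl
      where
      by-cases : ∀ b → Adj F x z ≡ b → z ≡ y
      by-cases true  Fxz = ⊥-elim (<-irrefl (trans (sym same) (colour-new Fxz)) (old<k Gxy Fxy))
      by-cases false Fxz = only (∖-edge G F Gxz Fxz) (trans (sym (colour-old Fxz)) (trans same (colour-old Fxy)))

  extend-by-star-forest : StarColouring G (suc k)
  extend-by-star-forest = record
    { colour     = colour
    ; colour-sym = λ x y → cong₂ (if_then k else_) (SimpleGraph.sym F x y) (C.colour-sym x y)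
    ; colour<    = colour<
    ; star       = star
    }
    where
    colour< : ∀ {x y} → Adj G x y ≡ true → colour x y < suc k
    colour< {x} {y} Gxy = by-cases (Adj F x y) refl
      where
      by-cases : ∀ b → Adj F x y ≡ b → colour x y < suc k
      by-cases true  Fxy = ≤-reflexive (cong suc (colour-new Fxy))
      by-cases false Fxy = m≤n⇒m≤1+n (old<k Gxy Fxy)

    star : ∀ {x y} → Adj G x y ≡ true → OnlyInColour G colour x y ⊎ OnlyInColour G colour y x
    star {x} {y} Gxy = by-cases (Adj F x y) refl
      where
      by-cases : ∀ b → Adj F x y ≡ b → OnlyInColour G colour x y ⊎ OnlyInColour G colour y x
      by-cases true  Fxy = Sum.map (only-new Fxy) (only-new (trans (SimpleGraph.sym F y x) Fxy)) (F-star Fxy)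
      by-cases false Fxy = Sum.map (only-old Gxy Fxy)
        (only-old (trans (SimpleGraph.sym G y x) Gxy) (trans (SimpleGraph.sym F y x) Fxy))
        (C.star (∖-edge G F Gxy Fxy))

weaken : {G : SimpleGraph n} {k k′ : ℕ} → k ≤ k′ → StarColouring G k → StarColouring G k′
weaken k≤k′ c = record
  { colour = colour ; colour-sym = colour-sym ; colour< = λ e → <-≤-trans (colour< e) k≤k′ ; star = star }
  where open StarColouring c

HasOtherNeighbour : SimpleGraph n → Fin n → Fin n → Set
HasOtherNeighbour F x y = ∃ λ z → z ≢ y × Adj F x z ≡ true

hasOtherNeighbour? : (F : SimpleGraph n) (x y : Fin n) → Dec (HasOtherNeighbour F x y)
hasOtherNeighbour? F x y = any? (λ z → ¬? (z ≟ᶠ y) ×-dec (Adj F x z Bool.≟ true))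

only-or-other : (F : SimpleGraph n) (x y : Fin n) → OnlyNeighbour F x y ⊎ HasOtherNeighbour F x y
only-or-other F x y with hasOtherNeighbour? F x y
... | yes other = inj₂ other
... | no  none  = inj₁ only
  where
  only : OnlyNeighbour F x y
  only {z} Fxz with z ≟ᶠ y
  ... | yes z≡y = z≡y
  ... | no  z≢y = ⊥-elim (none (z , z≢y , Fxz))

endpoint : Fin n → Fin n → Fin n → Bool
endpoint i j z = does (z ≟ᶠ i) ∨ does (z ≟ᶠ j)

deleteEdge : SimpleGraph n → Fin n → Fin n → SimpleGraph n
deleteEdge F i j = restrict F (λ x y → not (endpoint i j x ∧ endpoint i j y))
  (λ x y → cong not (Bool.∧-comm (endpoint i j x) (endpoint i j y)))

deleteEdge-deletes : (F : SimpleGraph n) (i j : Fin n) → Adj (deleteEdge F i j) i j ≡ false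
deleteEdge-deletes F i j
  rewrite dec-true (i ≟ᶠ i) refl | dec-true (j ≟ᶠ j) refl | Bool.∨-zeroʳ (does (j ≟ᶠ i))
  = Bool.∧-zeroʳ (Adj F i j)

deleteEdge-keeps : (F : SimpleGraph n) {i j x z : Fin n} → Adj F x z ≡ true → z ≢ i → z ≢ j →
  Adj (deleteEdge F i j) x z ≡ true
deleteEdge-keeps F {i} {j} {x} {z} Fxz z≢i z≢j
  rewrite Fxz | dec-false (z ≟ᶠ i) z≢i | dec-false (z ≟ᶠ j) z≢j | Bool.∧-zeroʳ (endpoint i j x) = refl

Covers : SimpleGraph n → SimpleGraph n → Set
Covers G F = ∀ {x y} → Adj G x y ≡ true → ∃ λ z → Adj F x z ≡ true

Settled : SimpleGraph n → Fin n × Fin n → Set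
Settled F (x , y) = Adj F x y ≡ true → OnlyNeighbour F x y ⊎ OnlyNeighbour F y x

settled-⊆ : (F F′ : SimpleGraph n) → F′ ⊆ᴳ F → ∀ p → Settled F p → Settled F′ p
settled-⊆ F F′ F′⊆F (x , y) settled F′xy =
  Sum.map (λ only F′xz → only (F′⊆F F′xz)) (λ only F′yz → only (F′⊆F F′yz)) (settled (F′⊆F F′xy))

prune : SimpleGraph n → Fin n × Fin n → SimpleGraph n
prune F (i , j) with hasOtherNeighbour? F i j ×-dec hasOtherNeighbour? F j i
... | yes _ = deleteEdge F i j
... | no  _ = F

prune-⊆ : (F : SimpleGraph n) (p : Fin n × Fin n) → prune F p ⊆ᴳ F
prune-⊆ F (i , j) with hasOtherNeighbour? F i j ×-dec hasOtherNeighbour? F j i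
... | yes _ = ∧-trueˡ
... | no  _ = λ Fxy → Fxy

prune-covers : (G F : SimpleGraph n) → Covers G F → ∀ p → Covers G (prune F p)
prune-covers G F covers (i , j) with hasOtherNeighbour? F i j ×-dec hasOtherNeighbour? F j i
... | no  _ = covers
... | yes ((z₁ , z₁≢j , Fiz₁) , (z₂ , z₂≢i , Fjz₂)) = λ Gxy → keep _ (covers Gxy)
  where
  keep : ∀ x → ∃ (λ z → Adj F x z ≡ true) → ∃ λ z → Adj (deleteEdge F i j) x z ≡ true
  keep x (z , Fxz) = by-cases (x ≟ᶠ i) (x ≟ᶠ j)
    where
    by-cases : Dec (x ≡ i) → Dec (x ≡ j) → ∃ λ z → Adj (deleteEdge F i j) x z ≡ true
    by-cases (yes refl) _          = z₁ , deleteEdge-keeps F Fiz₁ (edge⇒≢ F Fiz₁ ∘ sym) z₁≢j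
    by-cases (no _)     (yes refl) = z₂ , deleteEdge-keeps F Fjz₂ z₂≢i (edge⇒≢ F Fjz₂ ∘ sym)
    by-cases (no x≢i)   (no x≢j)   = z , trans (SimpleGraph.sym (deleteEdge F i j) x z)
                                            (deleteEdge-keeps F (trans (SimpleGraph.sym F z x) Fxz) x≢i x≢j)

prune-settles : (F : SimpleGraph n) (p : Fin n × Fin n) → Settled (prune F p) p
prune-settles F (i , j) with hasOtherNeighbour? F i j ×-dec hasOtherNeighbour? F j i
... | yes _ = λ e → ⊥-elim (case trans (sym (deleteEdge-deletes F i j)) e of λ ())
... | no  not-both = λ _ → settle (only-or-other F i j) (only-or-other F j i)
  where
  settle : OnlyNeighbour F i j ⊎ HasOtherNeighbour F i j → OnlyNeighbour F j i ⊎ HasOtherNeighbour F j i →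
    OnlyNeighbour F i j ⊎ OnlyNeighbour F j i
  settle (inj₁ only)  _            = inj₁ only
  settle (inj₂ _)     (inj₁ only)  = inj₂ only
  settle (inj₂ other) (inj₂ other′) = ⊥-elim (not-both (other , other′))

pruneAll : SimpleGraph n → List (Fin n × Fin n) → SimpleGraph n
pruneAll = foldl prune

pruneAll-⊆ : (F : SimpleGraph n) (ps : List (Fin n × Fin n)) → pruneAll F ps ⊆ᴳ F
pruneAll-⊆ F []       = λ Fxy → Fxy
pruneAll-⊆ F (p ∷ ps) = λ e → prune-⊆ F p (pruneAll-⊆ (prune F p) ps e)

pruneAll-covers : (G F : SimpleGraph n) → Covers G F → ∀ ps → Covers G (pruneAll F ps)
pruneAll-covers G F covers []       = covers
pruneAll-covers G F covers (p ∷ ps) = pruneAll-covers G (prune F p) (prune-covers G F covers p) ps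

pruneAll-settles : (F : SimpleGraph n) (ps : List (Fin n × Fin n)) {p : Fin n × Fin n} → p ∈ ps →
  Settled (pruneAll F ps) p
pruneAll-settles F (p ∷ ps) (here refl) =
  settled-⊆ (prune F p) (pruneAll (prune F p) ps) (pruneAll-⊆ (prune F p) ps) p (prune-settles F p)
pruneAll-settles F (q ∷ ps) (there p∈ps) = pruneAll-settles (prune F q) ps p∈ps

-- A minimal edge cover of the non-isolated vertices, which is necessarily a star forest.
starCover : SimpleGraph n → SimpleGraph n
starCover {n} G = pruneAll G (cartesianProduct (allFin n) (allFin n))

starCover-⊆ : (G : SimpleGraph n) → starCover G ⊆ᴳ G
starCover-⊆ {n} G = pruneAll-⊆ G (cartesianProduct (allFin n) (allFin n))

starCover-covers : (G : SimpleGraph n) → Covers G (starCover G)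
starCover-covers {n} G = pruneAll-covers G G (λ {x} {y} Gxy → y , Gxy) (cartesianProduct (allFin n) (allFin n))

starCover-starForest : (G : SimpleGraph n) → StarForest (starCover G)
starCover-starForest {n} G {x} {y} =
  pruneAll-settles G (cartesianProduct (allFin n) (allFin n)) (∈-cartesianProduct⁺ (∈-allFin x) (∈-allFin y))

-- Sparse graphs do not arrow P4

starColouring-maxDegree : ∀ k (G : SimpleGraph n) → (∀ x → degree G x ≤ k) → StarColouring G k
starColouring-maxDegree zero G Δ≤0 = record
  { colour = λ _ _ → 0 ; colour-sym = λ _ _ → refl ; colour< = no-edge ; star = no-edge }
  where
  no-edge : ∀ {A : Set} {x y} → Adj G x y ≡ true → A
  no-edge {x = x} Gxy = ⊥-elim (<⇒≱ (edge⇒degree≥1 G Gxy) (Δ≤0 x))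
starColouring-maxDegree (suc k) G Δ≤1+k =
  extend-by-star-forest G F (starCover-⊆ G) (starCover-starForest G) (starColouring-maxDegree k (G ∖ F) Δ≤k)
  where
  F = starCover G
  Δ≤k : ∀ x → degree (G ∖ F) x ≤ k
  Δ≤k x with degree G x ≤? 0
  ... | yes isolated = ≤-trans (m≤m+n _ (degree F x)) (≤-trans (≤-reflexive (sym (degree-∖ G F (starCover-⊆ G) x)))
                                                      (≤-trans isolated z≤n))
  ... | no  not-isolated with neighbour-outside G x [] (≰⇒> not-isolated)
  ...   | y , Gxy , _ with starCover-covers G Gxy
  ...     | z , Fxz = +-cancelʳ-≤ 1 (degree (G ∖ F) x) k (begin
    degree (G ∖ F) x + 1                   ≤⟨ +-monoʳ-≤ (degree (G ∖ F) x) (edge⇒degree≥1 F Fxz) ⟩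
    degree (G ∖ F) x + degree F x          ≡⟨ degree-∖ G F (starCover-⊆ G) x ⟨
    degree G x                             ≤⟨ Δ≤1+k x ⟩
    suc k                                  ≡⟨ +-comm 1 k ⟩
    k + 1                                  ∎)
    where open ≤-Reasoning

starAt : SimpleGraph n → Fin n → SimpleGraph n
starAt G v = restrict G (λ x y → does (x ≟ᶠ v) ∨ does (y ≟ᶠ v)) (λ x y → Bool.∨-comm (does (x ≟ᶠ v)) _)

starAt-⊆ : (G : SimpleGraph n) (v : Fin n) → starAt G v ⊆ᴳ G
starAt-⊆ G v = ∧-trueˡ

starAt-leaf : (G : SimpleGraph n) (v : Fin n) {x y : Fin n} → Adj (starAt G v) x y ≡ true → x ≢ v → y ≡ v
starAt-leaf G v {x} {y} e x≢v = by-cases (x ≟ᶠ v) (y ≟ᶠ v)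
  where
  by-cases : Dec (x ≡ v) → Dec (y ≡ v) → y ≡ v
  by-cases (yes x≡v) _         = ⊥-elim (x≢v x≡v)
  by-cases (no _)    (yes y≡v) = y≡v
  by-cases (no x≢v′) (no y≢v)  = ⊥-elim (case (begin
    false                                     ≡⟨ Bool.∧-zeroʳ (Adj G x y) ⟨
    Adj G x y ∧ false                         ≡⟨ cong₂ (λ a b → Adj G x y ∧ (a ∨ b)) (dec-false (x ≟ᶠ v) x≢v′)
                                                                                    (dec-false (y ≟ᶠ v) y≢v) ⟨
    Adj G x y ∧ (does (x ≟ᶠ v) ∨ does (y ≟ᶠ v)) ≡⟨ e ⟩
    true                                      ∎) of λ ())
    where open ≡-Reasoning

starAt-starForest : (G : SimpleGraph n) (v : Fin n) → StarForest (starAt G v)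
starAt-starForest G v {x} {y} e = by-cases (x ≟ᶠ v)
  where
  by-cases : Dec (x ≡ v) → OnlyNeighbour (starAt G v) x y ⊎ OnlyNeighbour (starAt G v) y x
  by-cases (yes refl) = inj₂ λ yz → starAt-leaf G v yz (edge⇒≢ (starAt G v) e ∘ sym)
  by-cases (no x≢v)   = inj₁ λ xz → trans (starAt-leaf G v xz x≢v) (sym (starAt-leaf G v e x≢v))

degreeSum-starAt : (G : SimpleGraph n) (v : Fin n) → degreeSum (starAt G v) ≡ degree G v + degree G v
degreeSum-starAt {n} G v = begin
  ∑[ x < n ] ∑[ y < n ] 𝟙 (Adj G x y ∧ (is-v x ∨ is-v y))
    ≡⟨ sum-cong-≗ (λ x → trans (sum-cong-≗ (λ y → 𝟙-∧-∨ (Adj G x y) (is-v x) (is-v y) (loopless x y)))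
                               (∑-distrib-+ (λ y → from-v x y) (to-v x))) ⟩
  ∑[ x < n ] (∑[ y < n ] from-v x y + ∑[ y < n ] to-v x y)
    ≡⟨ ∑-distrib-+ (λ x → ∑[ y < n ] from-v x y) (λ x → ∑[ y < n ] to-v x y) ⟩
  ∑[ x < n ] ∑[ y < n ] from-v x y + ∑[ x < n ] ∑[ y < n ] to-v x y
    ≡⟨ cong (_+ ∑[ x < n ] ∑[ y < n ] to-v x y) (∑-comm from-v) ⟩
  ∑[ y < n ] ∑[ x < n ] from-v x y + ∑[ x < n ] ∑[ y < n ] to-v x y
    ≡⟨ cong₂ _+_ (sum-cong-≗ (λ y → sum-select (λ x → Adj G x y) v)) (sum-cong-≗ (λ x → sum-select (Adj G x) v)) ⟩
  ∑[ y < n ] 𝟙 (Adj G v y) + ∑[ x < n ] 𝟙 (Adj G x v)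
    ≡⟨ cong (degree G v +_) (sum-cong-≗ (λ x → cong 𝟙 (SimpleGraph.sym G x v))) ⟩
  degree G v + degree G v ∎
  where
  open ≡-Reasoning
  is-v : Fin n → Bool
  is-v x = does (x ≟ᶠ v)
  from-v to-v : Fin n → Fin n → ℕ
  from-v x y = 𝟙 (Adj G x y ∧ is-v x)
  to-v   x y = 𝟙 (Adj G x y ∧ is-v y)
  𝟙-∧-∨ : ∀ g a b → (a ≡ true → b ≡ true → g ≡ false) →
    𝟙 (g ∧ (a ∨ b)) ≡ 𝟙 (g ∧ a) + 𝟙 (g ∧ b)
  𝟙-∧-∨ false a     b     _    = refl
  𝟙-∧-∨ true  true  true  both with () ← both refl refl
  𝟙-∧-∨ true  true  false _    = refl
  𝟙-∧-∨ true  false b     _    = refl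
  loopless : ∀ x y → is-v x ≡ true → is-v y ≡ true → Adj G x y ≡ false
  loopless x y x≡v y≡v with x ≟ᶠ v | y ≟ᶠ v
  ... | yes refl | yes refl = irrefl G v

-- The star at a vertex of degree > r becomes a new colour class; once all degrees are
-- at most r, r colours suffice.
starColouring-sparse : ∀ r (G : SimpleGraph n) → degreeSum G ≤ r * r → StarColouring G r
starColouring-sparse zero G D≤0 = starColouring-maxDegree 0 G (λ x → ≤-trans (term≤sum (degree G) x) D≤0)
starColouring-sparse (suc r) G D≤ with any? (λ v → suc r ≤? degree G v)
... | no  no-big = weaken (n≤1+n r) (starColouring-maxDegree r G (λ x → ≮⇒≥ (no-big ∘ (x ,_))))
... | yes (v , big) =
  extend-by-star-forest G (starAt G v) (starAt-⊆ G v) (starAt-starForest G v)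
    (starColouring-sparse r (G ∖ starAt G v) rest≤)
  where
  rest≤ : degreeSum (G ∖ starAt G v) ≤ r * r
  rest≤ = +-cancelʳ-≤ (suc r + suc r) _ (r * r) (begin
    degreeSum (G ∖ starAt G v) + (suc r + suc r)       ≤⟨ +-monoʳ-≤ _ (+-mono-≤ big big) ⟩
    degreeSum (G ∖ starAt G v) + (degree G v + degree G v)
                                                       ≡⟨ cong (degreeSum (G ∖ starAt G v) +_) (degreeSum-starAt G v) ⟨
    degreeSum (G ∖ starAt G v) + degreeSum (starAt G v) ≡⟨ degreeSum-∖ G (starAt G v) (starAt-⊆ G v) ⟨
    degreeSum G                                        ≤⟨ D≤ ⟩
    suc r * suc r                                      ≤⟨ m≤m+n _ 1 ⟩
    suc r * suc r + 1                                  ≡⟨ square-identity r ⟩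
    r * r + (suc r + suc r)                            ∎)
    where
    open ≤-Reasoning
    square-identity : ∀ r → suc r * suc r + 1 ≡ r * r + (suc r + suc r)
    square-identity = solve-∀

clamp : ∀ r → ℕ → Fin (suc r)
clamp r c = fromℕ< (s≤s (m⊓n≤n c r))

toℕ-clamp : ∀ {r c} → c ≤ r → toℕ (clamp r c) ≡ c
toℕ-clamp {r} {c} c≤r = trans (toℕ-fromℕ< (s≤s (m⊓n≤n c r))) (m≤n⇒m⊓n≡m c≤r)

-- In a monochromatic path a-b-c-d the middle edge bc would need an end with no other edge of its colour.
starColouring⇒¬arrows : ∀ r (G : SimpleGraph n) → StarColouring G (suc r) → ¬ Arrows (suc r) G
starColouring⇒¬arrows {n} r G c arrows = no-mono (arrows χ)
  where
  open StarColouring c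
  χ : EdgeColouring (suc r) n
  χ = record { col = λ x y → clamp r (colour x y) ; colSym = λ x y → cong (clamp r) (colour-sym x y) }
  same-colour : ∀ {p q s t} → Adj G p q ≡ true → Adj G s t ≡ true →
    clamp r (colour p q) ≡ clamp r (colour s t) → colour p q ≡ colour s t
  same-colour pq st eq =
    trans (sym (toℕ-clamp (s≤s⁻¹ (colour< pq)))) (trans (cong toℕ eq) (toℕ-clamp (s≤s⁻¹ (colour< st))))
  no-mono : ¬ MonoP4 G χ
  no-mono (a , b , x , d , (_ , a≢x , _ , _ , b≢d , _) , (ab , bx , xd) , (ab~bx , bx~xd)) with star bx
  ... | inj₁ only-b = a≢x (only-b (trans (SimpleGraph.sym G b a) ab) (trans (colour-sym b a) (same-colour ab bx ab~bx)))
  ... | inj₂ only-x = b≢d (sym (only-x xd (trans (sym (same-colour bx xd bx~xd)) (colour-sym b x))))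

¬arrows-if-sparse : ∀ r (G : SimpleGraph n) → 2 * edgeCount G ≤ suc r * suc r → ¬ Arrows (suc r) G
¬arrows-if-sparse r G sparse =
  starColouring⇒¬arrows r G (starColouring-sparse (suc r) G (subst (_≤ suc r * suc r) (sym (handshake G)) sparse))

-- Deleting isolated vertices

Isolated : SimpleGraph n → Fin n → Set
Isolated {n} G v = ∀ y → Adj G v y ≡ false

isolated-if-degree≤0 : (G : SimpleGraph n) (v : Fin n) → degree G v ≤ 0 → Isolated G v
isolated-if-degree≤0 G v degree≤0 y with Adj G v y in Gvy
... | false = refl
... | true  = ⊥-elim (<⇒≱ (edge⇒degree≥1 G Gvy) degree≤0)

deleteVertex : SimpleGraph (suc n) → Fin (suc n) → SimpleGraph n
deleteVertex G v = record
  { Adj    = λ x y → Adj G (punchIn v x) (punchIn v y)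
  ; sym    = λ x y → SimpleGraph.sym G (punchIn v x) (punchIn v y)
  ; irrefl = λ x → irrefl G (punchIn v x)
  }

degreeSum-deleteVertex : (G : SimpleGraph (suc n)) (v : Fin (suc n)) → Isolated G v →
  degreeSum (deleteVertex G v) ≡ degreeSum G
degreeSum-deleteVertex {n} G v isolated = sym (begin
  degreeSum G                                          ≡⟨ sum-remove {i = v} (degree G) ⟩
  degree G v + ∑[ x < n ] degree G (punchIn v x)
    ≡⟨ cong₂ _+_ (sum-zero (cong 𝟙 ∘ isolated)) (sum-cong-≗ degree-punchIn) ⟩
  0 + ∑[ x < n ] degree (deleteVertex G v) x           ∎)
  where
  open ≡-Reasoning
  degree-punchIn : ∀ x → degree G (punchIn v x) ≡ degree (deleteVertex G v) x
  degree-punchIn x = begin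
    degree G (punchIn v x)                                        ≡⟨ sum-remove {i = v} (𝟙 ∘ Adj G (punchIn v x)) ⟩
    𝟙 (Adj G (punchIn v x) v) + degree (deleteVertex G v) x
      ≡⟨ cong (λ b → 𝟙 b + degree (deleteVertex G v) x) (trans (SimpleGraph.sym G _ v) (isolated _)) ⟩
    0 + degree (deleteVertex G v) x                               ∎

edgeCount-deleteVertex : (G : SimpleGraph (suc n)) (v : Fin (suc n)) → Isolated G v →
  edgeCount (deleteVertex G v) ≡ edgeCount G
edgeCount-deleteVertex G v isolated = *-cancelˡ-≡ _ _ 2 (begin
  2 * edgeCount (deleteVertex G v)   ≡⟨ handshake (deleteVertex G v) ⟨
  degreeSum (deleteVertex G v)       ≡⟨ degreeSum-deleteVertex G v isolated ⟩
  degreeSum G                        ≡⟨ handshake G ⟩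
  2 * edgeCount G                    ∎)
  where open ≡-Reasoning

module _ {r : ℕ} (v : Fin (suc n)) (χ : EdgeColouring (suc r) n) where
  private
    colour : ∀ {x y} → Dec (v ≡ x) → Dec (v ≡ y) → Fin (suc r)
    colour (no v≢x) (no v≢y) = col χ (punchOut v≢x) (punchOut v≢y)
    colour _        _        = zero

  extendColouring : EdgeColouring (suc r) (suc n)
  extendColouring = record
    { col = λ x y → colour (v ≟ᶠ x) (v ≟ᶠ y) ; colSym = λ x y → colour-sym (v ≟ᶠ x) (v ≟ᶠ y) }
    where
    colour-sym : ∀ {x y} (v≟x : Dec (v ≡ x)) (v≟y : Dec (v ≡ y)) → colour v≟x v≟y ≡ colour v≟y v≟x
    colour-sym (no v≢x) (no v≢y) = colSym χ (punchOut v≢x) (punchOut v≢y)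
    colour-sym (no _)   (yes _)  = refl
    colour-sym (yes _)  (no _)   = refl
    colour-sym (yes _)  (yes _)  = refl

  extendColouring-col : ∀ {x y} (v≢x : v ≢ x) (v≢y : v ≢ y) →
    col extendColouring x y ≡ col χ (punchOut v≢x) (punchOut v≢y)
  extendColouring-col {x} {y} v≢x v≢y with v ≟ᶠ x | v ≟ᶠ y
  ... | yes v≡x | _       = ⊥-elim (v≢x v≡x)
  ... | no _    | yes v≡y = ⊥-elim (v≢y v≡y)
  ... | no _    | no _    = cong₂ (col χ) (punchOut-cong v refl) (punchOut-cong v refl)

arrows-deleteVertex : ∀ {r} (G : SimpleGraph (suc n)) (v : Fin (suc n)) → Isolated G v →
  Arrows (suc r) G → Arrows (suc r) (deleteVertex G v)
arrows-deleteVertex G v isolated arrows χ with arrows (extendColouring v χ)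
... | a , b , c , d , (a≢b , a≢c , a≢d , b≢c , b≢d , c≢d) , (ab , bc , cd) , (ab~bc , bc~cd) =
  punchOut v≢a , punchOut v≢b , punchOut v≢c , punchOut v≢d ,
  (distinct a≢b , distinct a≢c , distinct a≢d , distinct b≢c , distinct b≢d , distinct c≢d) ,
  (edge ab , edge bc , edge cd) ,
  (same-colour v≢a v≢b v≢c ab~bc , same-colour v≢b v≢c v≢d bc~cd)
  where
  avoids : ∀ {x y} → Adj G x y ≡ true → v ≢ x
  avoids {y = y} Gxy refl = case trans (sym (isolated y)) Gxy of λ ()
  v≢a = avoids ab
  v≢b = avoids bc
  v≢c = avoids cd
  v≢d = avoids (trans (SimpleGraph.sym G _ _) cd)
  distinct : ∀ {x y} {v≢x : v ≢ x} {v≢y : v ≢ y} → x ≢ y → punchOut v≢x ≢ punchOut v≢y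
  distinct {v≢x = v≢x} {v≢y} x≢y = x≢y ∘ punchOut-injective v≢x v≢y
  edge : ∀ {x y} {v≢x : v ≢ x} {v≢y : v ≢ y} → Adj G x y ≡ true →
    Adj (deleteVertex G v) (punchOut v≢x) (punchOut v≢y) ≡ true
  edge {v≢x = v≢x} {v≢y} Gxy rewrite punchIn-punchOut v≢x | punchIn-punchOut v≢y = Gxy
  same-colour : ∀ {x y z} (v≢x : v ≢ x) (v≢y : v ≢ y) (v≢z : v ≢ z) →
    col (extendColouring v χ) x y ≡ col (extendColouring v χ) y z →
    col χ (punchOut v≢x) (punchOut v≢y) ≡ col χ (punchOut v≢y) (punchOut v≢z)
  same-colour v≢x v≢y v≢z xy~yz =
    trans (sym (extendColouring-col v χ v≢x v≢y)) (trans xy~yz (extendColouring-col v χ v≢y v≢z))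

-- Deciding arrowing by exhaustive search

Searchable : Set → Set₁
Searchable A = ∀ {P : A → Set} → (∀ a → Dec (P a)) → Dec (∃ P)

searchable-Bool : Searchable Bool
searchable-Bool P? with P? false | P? true
... | yes p  | _      = yes (false , p)
... | no  _  | yes p  = yes (true , p)
... | no  ¬f | no  ¬t = no λ { (false , p) → ¬f p ; (true , p) → ¬t p }

searchable-Vec : ∀ {A} → Searchable A → ∀ n → Searchable (Vec A n)
searchable-Vec search zero    P? = Dec.map′ ([] ,_) (λ { ([] , p) → p }) (P? [])
searchable-Vec search (suc n) P? =
  Dec.map′ (λ { (a , as , p) → a ∷ as , p }) (λ { (a ∷ as , p) → a , as , p })
           (search (λ a → searchable-Vec search n (λ as → P? (a ∷ as))))

searchable-∀ : ∀ {A} → Searchable A → {P : A → Set} → (∀ a → Dec (P a)) → Dec (∀ a → P a)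
searchable-∀ search P? with search (λ a → ¬? (P? a))
... | yes (a , ¬p) = no λ all → ¬p (all a)
... | no  none     = yes λ a → decidable-stable (P? a) (λ ¬p → none (a , ¬p))

Matrix : Set → ℕ → Set
Matrix A n = Vec (Vec A n) n

entry : ∀ {A} → Matrix A n → Fin n → Fin n → A
entry M x y = Vec.lookup (Vec.lookup M x) y

tabulate₂ : ∀ {A} → (Fin n → Fin n → A) → Matrix A n
tabulate₂ f = Vec.tabulate (λ x → Vec.tabulate (f x))

entry-tabulate₂ : ∀ {A} (f : Fin n → Fin n → A) x y → entry (tabulate₂ f) x y ≡ f x y
entry-tabulate₂ f x y rewrite lookup∘tabulate (λ x → Vec.tabulate (f x)) x = lookup∘tabulate (f x) y

searchable-Matrix : ∀ {A} → Searchable A → ∀ n → Searchable (Matrix A n)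
searchable-Matrix search n = searchable-Vec (searchable-Vec search n) n

SymmetricMatrix : ∀ {A} → Matrix A n → Set
SymmetricMatrix M = ∀ x y → entry M x y ≡ entry M y x

symmetric? : ∀ {A} → DecidableEquality A → (M : Matrix A n) → Dec (SymmetricMatrix M)
symmetric? _≟_ M = all? λ x → all? λ y → entry M x y ≟ entry M y x

monoP4-cong : {r : ℕ} (G G′ : SimpleGraph n) (χ χ′ : EdgeColouring r n) →
  (∀ x y → Adj G x y ≡ Adj G′ x y) → (∀ x y → col χ x y ≡ col χ′ x y) → MonoP4 G χ → MonoP4 G′ χ′
monoP4-cong G G′ χ χ′ G≗G′ χ≗χ′ (a , b , c , d , distinct , (ab , bc , cd) , (ab~bc , bc~cd)) =
  a , b , c , d , distinct ,
  (trans (sym (G≗G′ a b)) ab , trans (sym (G≗G′ b c)) bc , trans (sym (G≗G′ c d)) cd) ,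
  (trans (sym (χ≗χ′ a b)) (trans ab~bc (χ≗χ′ b c)) , trans (sym (χ≗χ′ b c)) (trans bc~cd (χ≗χ′ c d)))

colouringOf : {r : ℕ} (M : Matrix (Fin r) n) → SymmetricMatrix M → EdgeColouring r n
colouringOf M M-sym = record { col = entry M ; colSym = M-sym }

-- Colourings are enumerated as matrices; MonoP4 only reads the entries, so it does not
-- depend on the symmetry proof.
arrows? : ∀ r (G : SimpleGraph n) → Dec (Arrows r G)
arrows? {n} r G = Dec.map′ arrows-of-matrices (λ arrows M M-sym → arrows (colouringOf M M-sym))
                          (searchable-∀ (searchable-Matrix any? n) mono?)
  where
  Mono : Matrix (Fin r) n → Set
  Mono M = (M-sym : SymmetricMatrix M) → MonoP4 G (colouringOf M M-sym)
  mono? : ∀ M → Dec (Mono M)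
  mono? M with symmetric? _≟ᶠ_ M
  ... | no  ¬sym = yes (⊥-elim ∘ ¬sym)
  ... | yes M-sym = Dec.map′ (λ mono _ → mono) (λ mono → mono M-sym) (monoP4? G (colouringOf M M-sym))
  arrows-of-matrices : (∀ M → Mono M) → Arrows r G
  arrows-of-matrices all-mono χ =
    monoP4-cong G G (colouringOf (tabulate₂ (col χ)) tabulated-sym) χ (λ _ _ → refl) (entry-tabulate₂ (col χ))
                (all-mono (tabulate₂ (col χ)) tabulated-sym)
    where
    tabulated-sym : SymmetricMatrix (tabulate₂ (col χ))
    tabulated-sym x y = trans (entry-tabulate₂ (col χ) x y) (trans (colSym χ x y) (sym (entry-tabulate₂ (col χ) y x)))

edgeCount-cong : (G G′ : SimpleGraph n) → (∀ x y → Adj G x y ≡ Adj G′ x y) → edgeCount G ≡ edgeCount G′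
edgeCount-cong {n} G G′ G≗G′ = begin
  edgeCount G                                      ≡⟨ edgeCount≡∑∑ G ⟩
  ∑[ i < n ] ∑[ j < n ] 𝟙 (i<j i j ∧ Adj G i j)    ≡⟨ sum-cong-≗ (λ i → sum-cong-≗ λ j → cong (λ b → 𝟙 (i<j i j ∧ b)) (G≗G′ i j)) ⟩
  ∑[ i < n ] ∑[ j < n ] 𝟙 (i<j i j ∧ Adj G′ i j)   ≡⟨ edgeCount≡∑∑ G′ ⟨
  edgeCount G′                                     ∎
  where
  open ≡-Reasoning
  i<j : Fin n → Fin n → Bool
  i<j i j = toℕ i <ᵇ toℕ j

graphOf : (M : Matrix Bool n) → SymmetricMatrix M → (∀ x → entry M x x ≡ false) → SimpleGraph n
graphOf M M-sym M-irrefl = record { Adj = entry M ; sym = M-sym ; irrefl = M-irrefl }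

ArrowingGraph : (r n k : ℕ) → Set
ArrowingGraph r n k = Σ (SimpleGraph n) λ G → Arrows r G × edgeCount G ≡ k

SmallArrowingGraph : (r k : ℕ) → Set
SmallArrowingGraph r k = ∃ λ n → n < suc (2 * k) × ArrowingGraph r n k

-- Non-isolated vertices number at most 2k, and isolated ones can be deleted.
compact : ∀ {r} n (G : SimpleGraph n) → Arrows (suc r) G → SmallArrowingGraph (suc r) (edgeCount G)
compact zero    G arrows = 0 , s≤s z≤n , G , arrows , refl
compact (suc n) G arrows with suc n ≤? 2 * edgeCount G
... | yes small = suc n , s≤s small , G , arrows , refl
... | no  large with any? (λ v → degree G v ≤? 0)
...   | yes (v , degree≤0) =
  subst (SmallArrowingGraph _) (edgeCount-deleteVertex G v isolated)
        (compact n (deleteVertex G v) (arrows-deleteVertex G v isolated arrows))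
  where isolated = isolated-if-degree≤0 G v degree≤0
...   | no  none = ⊥-elim (large (begin
  suc n            ≡⟨ trans (sum-const (suc n) 1) (*-identityʳ (suc n)) ⟨
  ∑[ v < suc n ] 1 ≤⟨ sum-mono-≤ (λ v → ≰⇒> (none ∘ (v ,_))) ⟩
  degreeSum G      ≡⟨ handshake G ⟩
  2 * edgeCount G  ∎))
  where open ≤-Reasoning

arrowingGraph? : ∀ r n k → Dec (ArrowingGraph r n k)
arrowingGraph? r n k =
  Dec.map′ (λ { (M , M-sym , M-irrefl , p) → graphOf M M-sym M-irrefl , p }) matrixOf
           (searchable-Matrix searchable-Bool n good?)
  where
  Good : Matrix Bool n → Set
  Good M = Σ (SymmetricMatrix M) λ M-sym → Σ (∀ x → entry M x x ≡ false) λ M-irrefl →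
           Arrows r (graphOf M M-sym M-irrefl) × edgeCount (graphOf M M-sym M-irrefl) ≡ k
  good? : ∀ M → Dec (Good M)
  good? M with symmetric? Bool._≟_ M | all? (λ x → entry M x x Bool.≟ false)
  ... | no ¬sym   | _             = no (¬sym ∘ proj₁)
  ... | yes _     | no ¬irrefl    = no (¬irrefl ∘ proj₁ ∘ proj₂)
  ... | yes M-sym | yes M-irrefl  = Dec.map′ (λ p → M-sym , M-irrefl , p) (λ { (_ , _ , p) → p })
    (arrows? r (graphOf M M-sym M-irrefl) ×-dec (edgeCount (graphOf M M-sym M-irrefl) ≟ k))
  matrixOf : ArrowingGraph r n k → ∃ Good
  matrixOf (G , arrows , edges) =
    M , M-sym , M-irrefl ,
    (λ χ → monoP4-cong G (graphOf M M-sym M-irrefl) χ χ (λ x y → sym (M≗G x y)) (λ _ _ → refl) (arrows χ)) ,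
    trans (edgeCount-cong (graphOf M M-sym M-irrefl) G M≗G) edges
    where
    M = tabulate₂ (Adj G)
    M≗G = entry-tabulate₂ (Adj G)
    M-sym : SymmetricMatrix M
    M-sym x y = trans (M≗G x y) (trans (SimpleGraph.sym G x y) (sym (M≗G y x)))
    M-irrefl : ∀ x → entry M x x ≡ false
    M-irrefl x = trans (M≗G x x) (irrefl G x)

smallArrowingGraph? : ∀ r k → Dec (SmallArrowingGraph r k)
smallArrowingGraph? r k = anyUpTo? (λ n → arrowingGraph? r n k) (suc (2 * k))

Least : (ℕ → Set) → Set
Least P = ∃ λ m → P m × (∀ {k} → P k → m ≤ k)

least : {P : ℕ → Set} → (∀ k → Dec (P k)) → ∀ {m} → P m → Least P
least {P} P? {m} Pm = <-rec (λ m → P m → Least P) step m Pm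
  where
  step : ∀ m → (∀ {k} → k < m → P k → Least P) → P m → Least P
  step m smaller Pm with anyUpTo? P? m
  ... | yes (k , k<m , Pk) = smaller k<m Pk
  ... | no  none           = m , Pm , λ Pk → ≮⇒≥ λ k<m → none (_ , k<m , Pk)

theorem1p5 : (r : ℕ) → 2 ≤ r →
    Σ ℕ λ m → IsSizeRamseyP4 r m × (r * r < 2 * m) × (m ≤ (r + 1) * (2 * r + 1))
theorem1p5 zero ()
theorem1p5 (suc r) _ = size-Ramsey-number (least (smallArrowingGraph? (suc r)) complete-small)
  where
  complete-small = compact _ (complete (2 + 2 * suc r)) (complete-arrows (suc r))
  size-Ramsey-number : Least (SmallArrowingGraph (suc r)) →
    Σ ℕ λ m → IsSizeRamseyP4 (suc r) m × (suc r * suc r < 2 * m) × (m ≤ (suc r + 1) * (2 * suc r + 1))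
  size-Ramsey-number (m , (n , _ , G , arrows , edges) , minimal) =
    m , ((n , G , arrows , edges) , λ n′ G′ arrows′ → minimal (compact n′ G′ arrows′)) ,
    ≰⇒> (λ 2m≤r² → ¬arrows-if-sparse r G (subst (λ e → 2 * e ≤ suc r * suc r) (sym edges) 2m≤r²) arrows) ,
    ≤-trans (minimal complete-small) (≤-reflexive (edgeCount-complete (suc r)))
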